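{- Let $K_1,K_2$ be two $q$-edge-colored ordered complete graphs, and let $S\subseteq[q]$ be any set of colors. Let $L_1,L_2$ be the maximum number of vertices of an $S$-colored monotone path in $K_1,K_2$, respectively. Then the maximum number of vertices of an $S$-colored monotone path in $K_1\otimes K_2$ is exactly $L_1L_2$.
   Context: An ordered complete graph is a complete graph with a linear order on its vertices; a path is monotone if its vertices, in traversal order, are increasing. A path is $S$-colored if all its edges have colors in $S$. The lexicographic product $K_1\otimes K_2$ is the $q$-edge-colored ordered complete graph on $V(K_2)\times V(K_1)$, ordered by $(u,x)<(u',x')$ iff $u<u'$, or $u=u'$ and $x<x'$; the edge between $(u,x)$ and $(u',x')$ receives the color of $uu'$ in $K_2$ if $u\neq u'$, and the color of $xx'$ in $K_1$ if $u=u'$. -}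

module Defs where

open import Data.Nat using (ℕ; _≤_)
open import Data.Fin using (Fin)
open import Data.Fin.Subset using (Subset; _∈_)
open import Data.Fin.Properties using () renaming (_≟_ to _≟ᶠ_)
import Data.Fin as F
open import Data.List using (List; length)
open import Data.List.Relation.Unary.Linked using (Linked)
open import Data.Product using (Σ; _×_; _,_; ∃)
open import Data.Sum using (_⊎_)
open import Relation.Binary.PropositionalEquality using (_≡_)
open import Relation.Nullary using (yes; no)

-- A q-edge-colored ordered complete graph on n vertices: the vertex set is
-- Fin n with its natural linear order; the color of the edge {u,v} with u < v
-- is col u v (col v u and col u u are never consulted).
record OCG (q : ℕ) : Set where
  field
    n   : ℕ
    col : Fin n → Fin n → Fin q
open OCG public

record OrdColGraph (q : ℕ) : Set₁ where
  field
    Vtx  : Set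
    _≺_  : Vtx → Vtx → Set
    ecol : Vtx → Vtx → Fin q

asGraph : ∀ {q} → OCG q → OrdColGraph q
asGraph K = record { Vtx = Fin (n K) ; _≺_ = F._<_ ; ecol = col K }

SMonoPath : ∀ {q} (G : OrdColGraph q) (S : Subset q) → List (OrdColGraph.Vtx G) → Set
SMonoPath G S = Linked (λ u v → (u ≺ v) × (ecol u v ∈ S))
  where open OrdColGraph G

IsMaxSMonoPathLength : ∀ {q} (G : OrdColGraph q) (S : Subset q) → ℕ → Set
IsMaxSMonoPathLength G S L =
  (Σ (List (OrdColGraph.Vtx G)) λ xs → SMonoPath G S xs × length xs ≡ L)
  × (∀ xs → SMonoPath G S xs → length xs ≤ L)

LexLt : ∀ {n₂ n₁} → Fin n₂ × Fin n₁ → Fin n₂ × Fin n₁ → Set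
LexLt (u , x) (u' , x') = (u F.< u') ⊎ ((u ≡ u') × (x F.< x'))

_⊗_ : ∀ {q} → OCG q → OCG q → OrdColGraph q
K₁ ⊗ K₂ = record
  { Vtx  = Fin (n K₂) × Fin (n K₁)
  ; _≺_  = LexLt
  ; ecol = λ { (u , x) (u' , x') → colorOf u x u' x' }
  }
  where
  colorOf : Fin (n K₂) → Fin (n K₁) → Fin (n K₂) → Fin (n K₁) → Fin _
  colorOf u x u' x' with u ≟ᶠ u'
  ... | yes _ = col K₁ x x'
  ... | no  _ = col K₂ u u'

{-# OPTIONS --safe #-}
-- A monotone path in K₁ ⊗ K₂ visits the columns {u} × V(K₁) in increasing
-- order of u, and inside a column it is an S-colored monotone path of K₁.
-- An edge between distinct columns u < u' has the color of uu' in K₂, so the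
-- columns visited form an S-colored monotone path of K₂: there are at most L₂
-- of them, each contributing at most L₁ vertices. Conversely, running a
-- longest path of K₁ inside each column of a longest path of K₂ gives an
-- S-colored monotone path with L₁ L₂ vertices.
module Submission where

open import Defs
open import Data.Nat using (ℕ; _*_; _+_; suc; _≤_; z≤n; s≤s)
open import Data.Nat.Properties
  using (≤-trans; +-monoˡ-≤; *-suc; *-monoʳ-≤; *-comm; module ≤-Reasoning)
open import Data.Fin using (Fin)
open import Data.Fin.Properties using (<⇒≢; _≟_)
open import Data.Fin.Subset using (Subset; _∈_)
open import Data.List using (List; []; _∷_; length; map; _++_; head; cartesianProduct)
open import Data.List.Properties using (length-++; length-map)
open import Data.List.Relation.Unary.Linked using ([]; [-]; _∷_; _∷′_)
open import Data.Maybe using (just)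
open import Data.Maybe.Relation.Binary.Connected using (Connected; just; just-nothing)
open import Data.Product using (Σ; ∃₂; _×_; _,_)
open import Data.Sum using (_⊎_; inj₁; inj₂)
open import Relation.Binary.PropositionalEquality
  using (_≡_; _≢_; refl; sym; trans; cong₂; subst; module ≡-Reasoning)
open import Relation.Nullary using (yes; no; contradiction)

SEdge : ∀ {q} (G : OrdColGraph q) (S : Subset q) → OrdColGraph.Vtx G → OrdColGraph.Vtx G → Set
SEdge G S u v = (u ≺ v) × (ecol u v ∈ S)
  where open OrdColGraph G

length-cartesianProduct : ∀ {A B : Set} (xs : List A) (ys : List B) →
  length (cartesianProduct xs ys) ≡ length xs * length ys
length-cartesianProduct [] ys = refl
length-cartesianProduct (x ∷ xs) ys = begin
  length (map (x ,_) ys ++ cartesianProduct xs ys)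
    ≡⟨ length-++ (map (x ,_) ys) ⟩
  length (map (x ,_) ys) + length (cartesianProduct xs ys)
    ≡⟨ cong₂ _+_ (length-map (x ,_) ys) (length-cartesianProduct xs ys) ⟩
  length ys + length xs * length ys
    ∎
  where open ≡-Reasoning

close-column : ∀ {m a L k} → m ≤ a + L * k → a ≤ L → m ≤ L * suc k
close-column {m} {a} {L} {k} m≤a+Lk a≤L = begin
  m          ≤⟨ m≤a+Lk ⟩
  a + L * k  ≤⟨ +-monoˡ-≤ (L * k) a≤L ⟩
  L + L * k  ≡⟨ sym (*-suc L k) ⟩
  L * suc k  ∎
  where open ≤-Reasoning

module Lexicographic {q} (K₁ K₂ : OCG q) (S : Subset q) where

  V : Set
  V = Fin (n K₂) × Fin (n K₁)

  Edge₁ : Fin (n K₁) → Fin (n K₁) → Set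
  Edge₁ = SEdge (asGraph K₁) S

  Edge₂ : Fin (n K₂) → Fin (n K₂) → Set
  Edge₂ = SEdge (asGraph K₂) S

  Edge : V → V → Set
  Edge = SEdge (K₁ ⊗ K₂) S

  Path₁ : List (Fin (n K₁)) → Set
  Path₁ = SMonoPath (asGraph K₁) S

  Path₂ : List (Fin (n K₂)) → Set
  Path₂ = SMonoPath (asGraph K₂) S

  Path : List V → Set
  Path = SMonoPath (K₁ ⊗ K₂) S

  ecol-⊗-≡ : ∀ u x x' → OrdColGraph.ecol (K₁ ⊗ K₂) (u , x) (u , x') ≡ col K₁ x x'
  ecol-⊗-≡ u x x' with u ≟ u
  ... | yes _   = refl
  ... | no u≢u = contradiction refl u≢u

  ecol-⊗-≢ : ∀ {u u'} x x' → u ≢ u' → OrdColGraph.ecol (K₁ ⊗ K₂) (u , x) (u' , x') ≡ col K₂ u u'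
  ecol-⊗-≢ {u} {u'} x x' u≢u' with u ≟ u'
  ... | yes u≡u' = contradiction u≡u' u≢u'
  ... | no _     = refl

  vertical-edge : ∀ {u x x'} → Edge₁ x x' → Edge (u , x) (u , x')
  vertical-edge {u} {x} {x'} (x<x' , c∈S) =
    inj₂ (refl , x<x') , subst (_∈ S) (sym (ecol-⊗-≡ u x x')) c∈S

  horizontal-edge : ∀ {u u' x x'} → Edge₂ u u' → Edge (u , x) (u' , x')
  horizontal-edge {x = x} {x'} (u<u' , c∈S) =
    inj₁ u<u' , subst (_∈ S) (sym (ecol-⊗-≢ x x' (<⇒≢ u<u'))) c∈S

  edge-⊗⁻ : ∀ {u u' x x'} → Edge (u , x) (u' , x') → Edge₂ u u' ⊎ (u ≡ u' × Edge₁ x x')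
  edge-⊗⁻ {x = x} {x'} (inj₁ u<u' , c∈S) =
    inj₁ (u<u' , subst (_∈ S) (ecol-⊗-≢ x x' (<⇒≢ u<u')) c∈S)
  edge-⊗⁻ {u} {x = x} {x'} (inj₂ (refl , x<x') , c∈S) =
    inj₂ (refl , x<x' , subst (_∈ S) (ecol-⊗-≡ u x x') c∈S)

  column-++ : ∀ {u xs rest} → Path₁ xs → Path rest →
    (∀ x → Connected Edge (just (u , x)) (head rest)) →
    Path (map (u ,_) xs ++ rest)
  column-++ []      p⁺ joins = p⁺
  column-++ [-]     p⁺ joins = joins _ ∷′ p⁺
  column-++ (e ∷ p) p⁺ joins = vertical-edge e ∷ column-++ p p⁺ joins

  cartesianProduct-path : ∀ {us x xs} → Path₂ us → Path₁ (x ∷ xs) →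
    Path (cartesianProduct us (x ∷ xs))
  cartesianProduct-path []       p₁ = []
  cartesianProduct-path [-]      p₁ = column-++ p₁ [] (λ _ → just-nothing)
  cartesianProduct-path (e ∷ p₂) p₁ =
    column-++ p₁ (cartesianProduct-path p₂ p₁) (λ _ → just (horizontal-edge e))

  path-of-length-* : ∀ {xs us} → Path₁ xs → Path₂ us →
    Σ (List V) λ zs → Path zs × length zs ≡ length xs * length us
  path-of-length-* {[]}          _  _  = [] , [] , refl
  path-of-length-* {x ∷ xs} {us} p₁ p₂ =
    cartesianProduct us (x ∷ xs) , cartesianProduct-path p₂ p₁ ,
    trans (length-cartesianProduct us (x ∷ xs)) (*-comm (length us) (length (x ∷ xs)))

  -- bs is the rest of the first column, us lists the columns visited after it.
  column-decomposition : ∀ {L₁} → (∀ xs → Path₁ xs → length xs ≤ L₁) →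
    ∀ {u x rest} → Path ((u , x) ∷ rest) →
    ∃₂ λ bs us → Path₁ (x ∷ bs) × Path₂ (u ∷ us) ×
                 length ((u , x) ∷ rest) ≤ length (x ∷ bs) + L₁ * length us
  column-decomposition bound [-] = [] , [] , [-] , [-] , s≤s z≤n
  column-decomposition bound (e ∷ p) with edge-⊗⁻ e | column-decomposition bound p
  ... | inj₂ (refl , e₁) | bs , us , p₁ , p₂ , ≤-split =
    _ ∷ bs , us , e₁ ∷ p₁ , p₂ , s≤s ≤-split
  ... | inj₁ e₂          | bs , us , p₁ , p₂ , ≤-split =
    [] , _ ∷ us , [-] , e₂ ∷ p₂ , s≤s (close-column ≤-split (bound _ p₁))

  path-length-≤ : ∀ {L₁ L₂} →
    (∀ xs → Path₁ xs → length xs ≤ L₁) → (∀ us → Path₂ us → length us ≤ L₂) →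
    ∀ zs → Path zs → length zs ≤ L₁ * L₂
  path-length-≤ bound₁ bound₂ [] _ = z≤n
  path-length-≤ {L₁} bound₁ bound₂ (_ ∷ _) p with column-decomposition bound₁ p
  ... | _ , _ , p₁ , p₂ , ≤-split =
    ≤-trans (close-column ≤-split (bound₁ _ p₁)) (*-monoʳ-≤ L₁ (bound₂ _ p₂))

proposition3p3 : ∀ {q} (K₁ K₂ : OCG q) (S : Subset q) (L₁ L₂ : ℕ) →
    IsMaxSMonoPathLength (asGraph K₁) S L₁ →
    IsMaxSMonoPathLength (asGraph K₂) S L₂ →
    IsMaxSMonoPathLength (K₁ ⊗ K₂) S (L₁ * L₂)
proposition3p3 K₁ K₂ S L₁ L₂ ((xs , p₁ , refl) , bound₁) ((us , p₂ , refl) , bound₂) =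
  path-of-length-* p₁ p₂ , path-length-≤ bound₁ bound₂
  where open Lexicographic K₁ K₂ S
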